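{- The modal logic $\Gamma(\mathbf{LV},\omega,1)$ has the uniform Lyndon interpolation property.
   Context: Modal formulas use variables, $\bot,\land,\lor,\neg,\to,\Box$. Positive/negative variables: $v^+(p)=\{p\}$, $v^-(p)=\emptyset$, $v^\circ(\bot)=\emptyset$, $\land,\lor,\Box$ preserve polarity, $v^\pm(\neg\varphi)=v^\mp(\varphi)$, $v^+(\varphi\to\psi)=v^-(\varphi)\cup v^+(\psi)$, $v^-(\varphi\to\psi)=v^+(\varphi)\cup v^-(\psi)$. $\Gamma(\mathbf{LV},\omega,1)$ is the set of modal formulas true at every world of every Kripke model on every finite frame of the following form: $W=\{r\}\cup C^0\cup C^1$ where $C^0,C^1$ are disjoint finite nonempty sets not containing $r$, and $R$ is reflexive, $rRx$ for all $x$, $xRy$ for all $x,y\in C^k$ ($k=0,1$), and no other pairs (a root below two distinct finite final clusters). A logic $L$ has the uniform Lyndon interpolation property iff for every formula $\varphi$ and finite sets $P^+,P^-$ of variables there is $\theta$ with $L\vdash\varphi\to\theta$, $v^\circ(\theta)\subseteq v^\circ(\varphi)\setminus P^\circ$ for $\circ\in\{+,-\}$, and $L\vdash\theta\to\psi$ for every $\psi$ with $L\vdash\varphi\to\psi$ and $v^\circ(\psi)\cap P^\circ=\emptyset$ for $\circ\in\{+,-\}$. -}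

module Defs where

open import Data.Nat using (ℕ; suc)
open import Data.Fin using (Fin)
open import Data.Bool using (Bool; true)
open import Data.Unit using (⊤; tt)
open import Data.Empty using (⊥)
open import Data.Sum using (_⊎_; inj₁; inj₂)
open import Data.Product using (_×_; Σ)
open import Data.List using (List)
open import Data.List.Membership.Propositional using (_∈_)
open import Relation.Nullary using (¬_)
open import Relation.Binary.PropositionalEquality using (_≡_)

Var : Set
Var = ℕ

data Fm : Set where
  var  : Var → Fm
  ⊥'   : Fm
  _∧'_ : Fm → Fm → Fm
  _∨'_ : Fm → Fm → Fm
  ¬'_  : Fm → Fm
  _⇒_  : Fm → Fm → Fm
  □_   : Fm → Fm

infixr 6 _∧'_
infixr 5 _∨'_
infixr 4 _⇒_
infix 7 ¬'_ □_

Pos Neg : Var → Fm → Set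
Pos p (var q)   = p ≡ q
Pos p ⊥'        = ⊥
Pos p (φ ∧' ψ)  = Pos p φ ⊎ Pos p ψ
Pos p (φ ∨' ψ)  = Pos p φ ⊎ Pos p ψ
Pos p (¬' φ)    = Neg p φ
Pos p (φ ⇒ ψ)   = Neg p φ ⊎ Pos p ψ
Pos p (□ φ)     = Pos p φ
Neg p (var q)   = ⊥
Neg p ⊥'        = ⊥
Neg p (φ ∧' ψ)  = Neg p φ ⊎ Neg p ψ
Neg p (φ ∨' ψ)  = Neg p φ ⊎ Neg p ψ
Neg p (¬' φ)    = Pos p φ
Neg p (φ ⇒ ψ)   = Pos p φ ⊎ Neg p ψ
Neg p (□ φ)     = Neg p φ

-- The frames of the class: a root r below two disjoint finite nonempty clusters
-- C⁰ (of size suc n) and C¹ (of size suc m).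
data World (n m : ℕ) : Set where
  root : World n m
  c₀   : Fin (suc n) → World n m
  c₁   : Fin (suc m) → World n m

R : ∀ {n m} → World n m → World n m → Set
R root   _      = ⊤
R (c₀ _) (c₀ _) = ⊤
R (c₁ _) (c₁ _) = ⊤
R (c₀ _) _      = ⊥
R (c₁ _) _      = ⊥

Valuation : ℕ → ℕ → Set
Valuation n m = Var → World n m → Bool

_,_⊨_ : ∀ {n m} → Valuation n m → World n m → Fm → Set
V , w ⊨ var p    = V p w ≡ true
V , w ⊨ ⊥'       = ⊥
V , w ⊨ (φ ∧' ψ) = (V , w ⊨ φ) × (V , w ⊨ ψ)
V , w ⊨ (φ ∨' ψ) = (V , w ⊨ φ) ⊎ (V , w ⊨ ψ)
V , w ⊨ (¬' φ)   = ¬ (V , w ⊨ φ)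
V , w ⊨ (φ ⇒ ψ)  = (V , w ⊨ φ) → (V , w ⊨ ψ)
V , w ⊨ (□ φ)    = ∀ v → R w v → V , v ⊨ φ

ΓLV : Fm → Set
ΓLV φ = ∀ (n m : ℕ) (V : Valuation n m) (w : World n m) → V , w ⊨ φ

UniformLyndonInterpolation : (Fm → Set) → Set
UniformLyndonInterpolation L =
  ∀ (φ : Fm) (P⁺ P⁻ : List Var) →
    ∃θ φ P⁺ P⁻
  where
  ∃θ : Fm → List Var → List Var → Set
  ∃θ φ P⁺ P⁻ = Σ Fm λ θ →
      L (φ ⇒ θ)
    × (∀ p → Pos p θ → Pos p φ × ¬ (p ∈ P⁺))
    × (∀ p → Neg p θ → Neg p φ × ¬ (p ∈ P⁻))
    × (∀ ψ → L (φ ⇒ ψ)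
           → (∀ p → Pos p ψ → ¬ (p ∈ P⁺))
           → (∀ p → Neg p ψ → ¬ (p ∈ P⁻))
           → L (θ ⇒ ψ))

{-# OPTIONS --safe #-}
-- Every world of a frame of the class is the image of a root under a p-morphism, so it suffices to look at
-- roots. Call the type of a world the set of variables of φ true there, and the profile of a rooted model the
-- type of its root together with the sets of types realized in its two clusters; each profile has a canonical
-- model. The interpolant is the disjunction, over the profiles whose canonical model satisfies φ, of a formula
-- saying in the permitted literals that the root has that profile. A model and the canonical model of its own
-- profile are spanned by a frame of the class mapping p-morphically onto both and preserving the variables
-- of φ, so the canonical model of a model of φ satisfies φ. Conversely, if a root satisfies the disjunct of
-- such a profile, the span of the two models, with a valuation pushed towards the canonical one according to
-- the polarity of each variable in φ, satisfies φ and hence every consequence ψ; and ψ transfers back because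
-- its literals are permitted ones, on which the pushed valuation agrees with the given one.
module Submission where

open import Defs
open import Level using (0ℓ)
open import Function using (_∘_; id)
open import Function.Definitions using (StrictlySurjective)
open import Data.Nat using (ℕ; suc; _+_)
open import Data.Nat.Properties using (_≟_)
open import Data.Fin using (Fin; zero; suc; splitAt; _↑ˡ_; _↑ʳ_)
open import Data.Fin.Properties using (all?; any?; splitAt-↑ˡ; splitAt-↑ʳ)
open import Data.Bool using (Bool; true; false; _∧_; _∨_; if_then_else_)
import Data.Bool.Properties as Bool
open import Data.Unit using (tt)
open import Data.Empty using (⊥-elim)
open import Data.Sum using (_⊎_; inj₁; inj₂; [_,_])
import Data.Sum as Sum
open import Data.Product using (_×_; _,_; proj₁; proj₂; ∃-syntax; Σ-syntax; uncurry; map₂)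
open import Data.List
  using (List; []; _∷_; map; _++_; length; lookup; filter; cartesianProduct; cartesianProductWith)
open import Data.List.NonEmpty using (List⁺; _∷_; toList; tail)
open import Data.List.Properties using (≡-dec)
open import Data.List.Membership.Propositional using (_∈_; _∉_)
open import Data.List.Membership.Propositional.Properties
  using ( ∈-map⁺; ∈-++⁺ˡ; ∈-++⁺ʳ; ∈-lookup; ∈-filter⁺; ∈-filter⁻
        ; ∈-cartesianProduct⁺; ∈-cartesianProductWith⁺)
open import Data.List.Membership.DecPropositional _≟_ using (_∈?_)
open import Data.List.Relation.Unary.Any using (here; there; index)
open import Data.List.Relation.Unary.Any.Properties using (lookup-index)
open import Relation.Nullary using (Dec; yes; no; does)
open import Relation.Nullary.Decidable using (_×-dec_; _⊎-dec_; _→-dec_; ¬?)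
open import Relation.Unary using (Pred; _⊆_; Decidable)
open import Relation.Binary.PropositionalEquality using (_≡_; refl; sym; trans; cong; subst)

variable
  n m n′ m′ d : ℕ
  A B : Set

⊤' : Fm
⊤' = ¬' ⊥'

infix 7 ◇_
◇_ : Fm → Fm
◇ ψ = ¬' □ ¬' ψ

⋁ ⋀ : List A → (A → Fm) → Fm
⋁ []       f = ⊥'
⋁ (x ∷ xs) f = f x ∨' ⋁ xs f
⋀ []       f = ⊤'
⋀ (x ∷ xs) f = f x ∧' ⋀ xs f

when : {P : Set} → Dec P → Fm → Fm
when (yes _) ψ = ψ
when (no _)  _ = ⊤'

R? : (u v : World n m) → Dec (R u v)
R? root   _      = yes tt
R? (c₀ _) (c₀ _) = yes tt
R? (c₁ _) (c₁ _) = yes tt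
R? (c₀ _) root   = no λ ()
R? (c₀ _) (c₁ _) = no λ ()
R? (c₁ _) root   = no λ ()
R? (c₁ _) (c₀ _) = no λ ()

∀-world? : {P : World n m → Set} → (∀ w → Dec (P w)) → Dec (∀ w → P w)
∀-world? P? with P? root | all? (P? ∘ c₀) | all? (P? ∘ c₁)
... | yes p | yes p₀ | yes p₁ = yes λ { root → p ; (c₀ i) → p₀ i ; (c₁ i) → p₁ i }
... | no ¬p | _      | _      = no λ p → ¬p (p root)
... | yes _ | no ¬p₀ | _      = no λ p → ¬p₀ (p ∘ c₀)
... | yes _ | yes _  | no ¬p₁ = no λ p → ¬p₁ (p ∘ c₁)

∃-world? : {P : World n m → Set} → (∀ w → Dec (P w)) → Dec (∃[ w ] P w)
∃-world? P? with P? root | any? (P? ∘ c₀) | any? (P? ∘ c₁)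
... | yes p | _            | _            = yes (root , p)
... | no _  | yes (i , p₀) | _            = yes (c₀ i , p₀)
... | no _  | no _         | yes (i , p₁) = yes (c₁ i , p₁)
... | no ¬p | no ¬p₀       | no ¬p₁       =
  no λ { (root , p) → ¬p p ; (c₀ i , p₀) → ¬p₀ (i , p₀) ; (c₁ i , p₁) → ¬p₁ (i , p₁) }

_,_⊨?_ : (V : Valuation n m) (w : World n m) (ψ : Fm) → Dec (V , w ⊨ ψ)
V , w ⊨? var p    = V p w Bool.≟ true
V , w ⊨? ⊥'       = no λ ()
V , w ⊨? (ψ ∧' χ) = (V , w ⊨? ψ) ×-dec (V , w ⊨? χ)
V , w ⊨? (ψ ∨' χ) = (V , w ⊨? ψ) ⊎-dec (V , w ⊨? χ)
V , w ⊨? (¬' ψ)   = ¬? (V , w ⊨? ψ)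
V , w ⊨? (ψ ⇒ χ)  = (V , w ⊨? ψ) →-dec (V , w ⊨? χ)
V , w ⊨? (□ ψ)    = ∀-world? λ v → R? w v →-dec (V , v ⊨? ψ)

module _ {V : Valuation n m} {u : World n m} where

  ◇-intro : ∀ {v} ψ → R u v → V , v ⊨ ψ → V , u ⊨ (◇ ψ)
  ◇-intro _ r h ¬◇ = ¬◇ _ r h

  ◇-elim : ∀ ψ → V , u ⊨ (◇ ψ) → ∃[ v ] R u v × V , v ⊨ ψ
  ◇-elim ψ h with ∃-world? (λ v → R? u v ×-dec (V , v ⊨? ψ))
  ... | yes found = found
  ... | no ∄ = ⊥-elim (h λ v r s → ∄ (v , r , s))

module _ {V : Valuation n m} {u : World n m} where

  ⋁-intro : ∀ {xs : List A} {x f} → x ∈ xs → V , u ⊨ f x → V , u ⊨ ⋁ xs f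
  ⋁-intro (here refl) h = inj₁ h
  ⋁-intro (there x∈)  h = inj₂ (⋁-intro x∈ h)

  ⋁-elim : ∀ (xs : List A) f → V , u ⊨ ⋁ xs f → ∃[ i ] V , u ⊨ f (lookup xs i)
  ⋁-elim (x ∷ xs) f (inj₁ h) = zero , h
  ⋁-elim (x ∷ xs) f (inj₂ h) = let i , h′ = ⋁-elim xs f h in suc i , h′

  ⋀-intro : ∀ (xs : List A) f → (∀ i → V , u ⊨ f (lookup xs i)) → V , u ⊨ ⋀ xs f
  ⋀-intro []       f h = λ ()
  ⋀-intro (x ∷ xs) f h = h zero , ⋀-intro xs f (h ∘ suc)

  ⋀-elim : ∀ {xs : List A} {x} f → V , u ⊨ ⋀ xs f → x ∈ xs → V , u ⊨ f x
  ⋀-elim f (h , _) (here refl) = h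
  ⋀-elim f (_ , h) (there x∈)  = ⋀-elim f h x∈

  when-intro : ∀ {P ψ} (P? : Dec P) → (P → V , u ⊨ ψ) → V , u ⊨ when P? ψ
  when-intro (yes p) h = h p
  when-intro (no _)  _ = λ ()

  when-elim : ∀ {P ψ} (P? : Dec P) → P → V , u ⊨ when P? ψ → V , u ⊨ ψ
  when-elim (yes _) _ h = h
  when-elim (no ¬p) p _ = ⊥-elim (¬p p)

v⁺ v⁻ : Fm → Pred Var 0ℓ
v⁺ ψ p = Pos p ψ
v⁻ ψ p = Neg p ψ

Pos? : ∀ p ψ → Dec (Pos p ψ)
Neg? : ∀ p ψ → Dec (Neg p ψ)
Pos? p (var q)  = p ≟ q
Pos? p ⊥'       = no λ ()
Pos? p (ψ ∧' χ) = Pos? p ψ ⊎-dec Pos? p χ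
Pos? p (ψ ∨' χ) = Pos? p ψ ⊎-dec Pos? p χ
Pos? p (¬' ψ)   = Neg? p ψ
Pos? p (ψ ⇒ χ)  = Neg? p ψ ⊎-dec Pos? p χ
Pos? p (□ ψ)    = Pos? p ψ
Neg? p (var q)  = no λ ()
Neg? p ⊥'       = no λ ()
Neg? p (ψ ∧' χ) = Neg? p ψ ⊎-dec Neg? p χ
Neg? p (ψ ∨' χ) = Neg? p ψ ⊎-dec Neg? p χ
Neg? p (¬' ψ)   = Pos? p ψ
Neg? p (ψ ⇒ χ)  = Pos? p ψ ⊎-dec Neg? p χ
Neg? p (□ ψ)    = Neg? p ψ

vars : Fm → List Var
vars (var q)  = q ∷ []
vars ⊥'       = []
vars (ψ ∧' χ) = vars ψ ++ vars χ
vars (ψ ∨' χ) = vars ψ ++ vars χ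
vars (¬' ψ)   = vars ψ
vars (ψ ⇒ χ)  = vars ψ ++ vars χ
vars (□ ψ)    = vars ψ

v⁺⊆vars : ∀ ψ → v⁺ ψ ⊆ (_∈ vars ψ)
v⁻⊆vars : ∀ ψ → v⁻ ψ ⊆ (_∈ vars ψ)
v⁺⊆vars (var q)  refl     = here refl
v⁺⊆vars (ψ ∧' χ) (inj₁ h) = ∈-++⁺ˡ (v⁺⊆vars ψ h)
v⁺⊆vars (ψ ∧' χ) (inj₂ h) = ∈-++⁺ʳ (vars ψ) (v⁺⊆vars χ h)
v⁺⊆vars (ψ ∨' χ) (inj₁ h) = ∈-++⁺ˡ (v⁺⊆vars ψ h)
v⁺⊆vars (ψ ∨' χ) (inj₂ h) = ∈-++⁺ʳ (vars ψ) (v⁺⊆vars χ h)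
v⁺⊆vars (¬' ψ)   h        = v⁻⊆vars ψ h
v⁺⊆vars (ψ ⇒ χ)  (inj₁ h) = ∈-++⁺ˡ (v⁻⊆vars ψ h)
v⁺⊆vars (ψ ⇒ χ)  (inj₂ h) = ∈-++⁺ʳ (vars ψ) (v⁺⊆vars χ h)
v⁺⊆vars (□ ψ)    h        = v⁺⊆vars ψ h
v⁻⊆vars (ψ ∧' χ) (inj₁ h) = ∈-++⁺ˡ (v⁻⊆vars ψ h)
v⁻⊆vars (ψ ∧' χ) (inj₂ h) = ∈-++⁺ʳ (vars ψ) (v⁻⊆vars χ h)
v⁻⊆vars (ψ ∨' χ) (inj₁ h) = ∈-++⁺ˡ (v⁻⊆vars ψ h)
v⁻⊆vars (ψ ∨' χ) (inj₂ h) = ∈-++⁺ʳ (vars ψ) (v⁻⊆vars χ h)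
v⁻⊆vars (¬' ψ)   h        = v⁺⊆vars ψ h
v⁻⊆vars (ψ ⇒ χ)  (inj₁ h) = ∈-++⁺ˡ (v⁺⊆vars ψ h)
v⁻⊆vars (ψ ⇒ χ)  (inj₂ h) = ∈-++⁺ʳ (vars ψ) (v⁻⊆vars χ h)
v⁻⊆vars (□ ψ)    h        = v⁻⊆vars ψ h

record Within (P N : Pred Var 0ℓ) (ψ : Fm) : Set where
  constructor _,_
  field
    pos : v⁺ ψ ⊆ P
    neg : v⁻ ψ ⊆ N
open Within

module _ {P N : Pred Var 0ℓ} where

  ⊤-within : Within P N ⊤'
  ⊤-within = (λ ()) , (λ ())

  ∧-within : ∀ {ψ χ} → Within P N ψ → Within P N χ → Within P N (ψ ∧' χ)
  ∧-within (ψ⁺ , ψ⁻) (χ⁺ , χ⁻) = [ ψ⁺ , χ⁺ ] , [ ψ⁻ , χ⁻ ]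

  ∨-within : ∀ {ψ χ} → Within P N ψ → Within P N χ → Within P N (ψ ∨' χ)
  ∨-within (ψ⁺ , ψ⁻) (χ⁺ , χ⁻) = [ ψ⁺ , χ⁺ ] , [ ψ⁻ , χ⁻ ]

  □-within : ∀ {ψ} → Within P N ψ → Within P N (□ ψ)
  □-within (ψ⁺ , ψ⁻) = ψ⁺ , ψ⁻

  ◇-within : ∀ {ψ} → Within P N ψ → Within P N (◇ ψ)
  ◇-within (ψ⁺ , ψ⁻) = ψ⁺ , ψ⁻

  ⋁-within : ∀ (xs : List A) {f} → (∀ x → Within P N (f x)) → Within P N (⋁ xs f)
  ⋁-within []       _ = (λ ()) , (λ ())
  ⋁-within (x ∷ xs) w = ∨-within (w x) (⋁-within xs w)

  ⋀-within : ∀ (xs : List A) {f} → (∀ x → Within P N (f x)) → Within P N (⋀ xs f)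
  ⋀-within []       _ = ⊤-within
  ⋀-within (x ∷ xs) w = ∧-within (w x) (⋀-within xs w)

  when-within : ∀ {Q ψ} (Q? : Dec Q) → (Q → Within P N ψ) → Within P N (when Q? ψ)
  when-within (yes q) w = w q
  when-within (no _)  _ = ⊤-within

record PMorphism (n m n′ m′ : ℕ) : Set where
  field
    to    : World n m → World n′ m′
    forth : ∀ {u v} → R u v → R (to u) (to v)
    back  : ∀ {u v′} → R (to u) v′ → ∃[ v ] R u v × to v ≡ v′
open PMorphism

module _ (f : PMorphism n m n′ m′) (V : Valuation n m) (V′ : Valuation n′ m′) where

  Up Down : Pred Var 0ℓ
  Up p   = ∀ u → V p u ≡ true → V′ p (to f u) ≡ true
  Down p = ∀ u → V′ p (to f u) ≡ true → V p u ≡ true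

  ⊨-transfer : ∀ ψ → v⁺ ψ ⊆ Up → v⁻ ψ ⊆ Down → ∀ u → V , u ⊨ ψ → V′ , to f u ⊨ ψ
  ⊨-reflect  : ∀ ψ → v⁻ ψ ⊆ Up → v⁺ ψ ⊆ Down → ∀ u → V′ , to f u ⊨ ψ → V , u ⊨ ψ
  ⊨-transfer (var q)  up _    u h          = up refl u h
  ⊨-transfer (ψ ∧' χ) up down u (h , h′)   = ⊨-transfer ψ (up ∘ inj₁) (down ∘ inj₁) u h
                                           , ⊨-transfer χ (up ∘ inj₂) (down ∘ inj₂) u h′
  ⊨-transfer (ψ ∨' χ) up down u (inj₁ h)   = inj₁ (⊨-transfer ψ (up ∘ inj₁) (down ∘ inj₁) u h)
  ⊨-transfer (ψ ∨' χ) up down u (inj₂ h)   = inj₂ (⊨-transfer χ (up ∘ inj₂) (down ∘ inj₂) u h)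
  ⊨-transfer (¬' ψ)   up down u ¬h h       = ¬h (⊨-reflect ψ up down u h)
  ⊨-transfer (ψ ⇒ χ)  up down u h→ h        =
    ⊨-transfer χ (up ∘ inj₂) (down ∘ inj₂) u (h→ (⊨-reflect ψ (up ∘ inj₁) (down ∘ inj₁) u h))
  ⊨-transfer (□ ψ)    up down u h v′ r with back f r
  ... | v , r′ , refl = ⊨-transfer ψ up down v (h v r′)
  ⊨-reflect (var q)  _  down u h           = down refl u h
  ⊨-reflect (ψ ∧' χ) up down u (h , h′)   = ⊨-reflect ψ (up ∘ inj₁) (down ∘ inj₁) u h
                                           , ⊨-reflect χ (up ∘ inj₂) (down ∘ inj₂) u h′
  ⊨-reflect (ψ ∨' χ) up down u (inj₁ h)   = inj₁ (⊨-reflect ψ (up ∘ inj₁) (down ∘ inj₁) u h)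
  ⊨-reflect (ψ ∨' χ) up down u (inj₂ h)   = inj₂ (⊨-reflect χ (up ∘ inj₂) (down ∘ inj₂) u h)
  ⊨-reflect (¬' ψ)   up down u ¬h h       = ¬h (⊨-transfer ψ up down u h)
  ⊨-reflect (ψ ⇒ χ)  up down u h→ h        =
    ⊨-reflect χ (up ∘ inj₂) (down ∘ inj₂) u (h→ (⊨-transfer ψ (up ∘ inj₁) (down ∘ inj₁) u h))
  ⊨-reflect (□ ψ)    up down u h v r       = ⊨-reflect ψ up down v (h (to f v) (forth f r))

pullback : Valuation n′ m′ → PMorphism n m n′ m′ → Valuation n m
pullback V f p u = V p (to f u)

module _ (f : PMorphism n m n′ m′) (V : Valuation n′ m′) where

  ⊨-pullback : ∀ ψ u → V , to f u ⊨ ψ → pullback V f , u ⊨ ψ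
  ⊨-pullback ψ = ⊨-reflect f (pullback V f) V ψ (λ _ _ h → h) (λ _ _ h → h)

  pullback-⊨ : ∀ ψ u → pullback V f , u ⊨ ψ → V , to f u ⊨ ψ
  pullback-⊨ ψ = ⊨-transfer f (pullback V f) V ψ (λ _ _ h → h) (λ _ _ h → h)

swap : PMorphism n m m n
swap = record { to = to′ ; forth = forth′ ; back = back′ }
  where
  to′ : World n m → World m n
  to′ root   = root
  to′ (c₀ i) = c₁ i
  to′ (c₁ i) = c₀ i

  forth′ : ∀ {u v} → R u v → R (to′ u) (to′ v)
  forth′ {root}          _ = tt
  forth′ {c₀ _} {c₀ _}   _ = tt
  forth′ {c₁ _} {c₁ _}   _ = tt

  back′ : ∀ {u v′} → R (to′ u) v′ → ∃[ v ] R u v × to′ v ≡ v′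
  back′ {root} {root}  _ = root , tt , refl
  back′ {root} {c₀ i}  _ = c₁ i , tt , refl
  back′ {root} {c₁ i}  _ = c₀ i , tt , refl
  back′ {c₀ _} {c₁ i}  _ = c₀ i , tt , refl
  back′ {c₁ _} {c₀ i}  _ = c₁ i , tt , refl

-- A cluster world is the image of the root of a frame whose two clusters are copies of its own.
rootedAt₀ : Fin (suc n) → PMorphism n n n m
rootedAt₀ i = record { to = to′ ; forth = forth′ ; back = back′ }
  where
  to′ : World _ _ → World _ _
  to′ root   = c₀ i
  to′ (c₀ k) = c₀ k
  to′ (c₁ k) = c₀ k

  forth′ : ∀ {u v} → R u v → R (to′ u) (to′ v)
  forth′ {root} {root} _ = tt
  forth′ {root} {c₀ _} _ = tt
  forth′ {root} {c₁ _} _ = tt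
  forth′ {c₀ _} {c₀ _} _ = tt
  forth′ {c₁ _} {c₁ _} _ = tt

  back′ : ∀ {u v′} → R (to′ u) v′ → ∃[ v ] R u v × to′ v ≡ v′
  back′ {root} {c₀ k} _ = c₀ k , tt , refl
  back′ {c₀ _} {c₀ k} _ = c₀ k , tt , refl
  back′ {c₁ _} {c₀ k} _ = c₁ k , tt , refl

rootedAt₁ : Fin (suc m) → PMorphism m m n m
rootedAt₁ i = record { to = to′ ; forth = forth′ ; back = back′ }
  where
  to′ : World _ _ → World _ _
  to′ root   = c₁ i
  to′ (c₀ k) = c₁ k
  to′ (c₁ k) = c₁ k

  forth′ : ∀ {u v} → R u v → R (to′ u) (to′ v)
  forth′ {root} {root} _ = tt
  forth′ {root} {c₀ _} _ = tt
  forth′ {root} {c₁ _} _ = tt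
  forth′ {c₀ _} {c₀ _} _ = tt
  forth′ {c₁ _} {c₁ _} _ = tt

  back′ : ∀ {u v′} → R (to′ u) v′ → ∃[ v ] R u v × to′ v ≡ v′
  back′ {root} {c₁ k} _ = c₁ k , tt , refl
  back′ {c₀ _} {c₁ k} _ = c₀ k , tt , refl
  back′ {c₁ _} {c₁ k} _ = c₁ k , tt , refl

ΓLV-from-roots : ∀ ψ → (∀ n m (V : Valuation n m) → V , root ⊨ ψ) → ΓLV ψ
ΓLV-from-roots _ h n m V root   = h n m V
ΓLV-from-roots ψ h n m V (c₀ i) = pullback-⊨ (rootedAt₀ i) V ψ root (h n n (pullback V (rootedAt₀ i)))
ΓLV-from-roots ψ h n m V (c₁ i) = pullback-⊨ (rootedAt₁ i) V ψ root (h m m (pullback V (rootedAt₁ i)))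

clusterwise : (f₀ : Fin (suc n) → Fin (suc n′)) (f₁ : Fin (suc m) → Fin (suc m′)) →
              StrictlySurjective _≡_ f₀ → StrictlySurjective _≡_ f₁ → PMorphism n m n′ m′
clusterwise f₀ f₁ onto₀ onto₁ = record { to = to′ ; forth = forth′ ; back = back′ }
  where
  to′ : World _ _ → World _ _
  to′ root   = root
  to′ (c₀ i) = c₀ (f₀ i)
  to′ (c₁ i) = c₁ (f₁ i)

  forth′ : ∀ {u v} → R u v → R (to′ u) (to′ v)
  forth′ {root}        _ = tt
  forth′ {c₀ _} {c₀ _} _ = tt
  forth′ {c₁ _} {c₁ _} _ = tt

  hit₀ : ∀ u j → R u (c₀ (proj₁ (onto₀ j))) → ∃[ v ] R u v × to′ v ≡ c₀ j
  hit₀ _ j r = c₀ (proj₁ (onto₀ j)) , r , cong c₀ (proj₂ (onto₀ j))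

  hit₁ : ∀ u j → R u (c₁ (proj₁ (onto₁ j))) → ∃[ v ] R u v × to′ v ≡ c₁ j
  hit₁ _ j r = c₁ (proj₁ (onto₁ j)) , r , cong c₁ (proj₂ (onto₁ j))

  back′ : ∀ {u v′} → R (to′ u) v′ → ∃[ v ] R u v × to′ v ≡ v′
  back′ {root} {root} _ = root , tt , refl
  back′ {root} {c₀ j} _ = hit₀ root j tt
  back′ {root} {c₁ j} _ = hit₁ root j tt
  back′ {c₀ i} {c₀ j} _ = hit₀ (c₀ i) j tt
  back′ {c₁ i} {c₁ j} _ = hit₁ (c₁ i) j tt

record IsCluster (e : Fin (suc d) → World n m) : Set where
  field
    connected : ∀ k k′ → R (e k) (e k′)
    closed    : ∀ k {v} → R (e k) v → ∃[ k′ ] v ≡ e k′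
open IsCluster

c₀-cluster : IsCluster {n = n} {m} c₀
c₀-cluster = record { connected = λ _ _ → tt ; closed = λ { _ {c₀ k′} _ → k′ , refl } }

c₁-cluster : IsCluster {n = n} {m} c₁
c₁-cluster = record { connected = λ _ _ → tt ; closed = λ { _ {c₁ k′} _ → k′ , refl } }

◇-in-cluster : {V : Valuation n m} {e : Fin (suc d) → World n m} → IsCluster e →
               ∀ {k} ψ → V , e k ⊨ (◇ ψ) → ∃[ k′ ] V , e k′ ⊨ ψ
◇-in-cluster e-cluster ψ h with ◇-elim ψ h
... | _ , r , h′ with closed e-cluster _ r
... | k′ , refl = k′ , h′

record Bitotal {A B : Set} (Y : A → B → Set) : Set where
  field
    left-total  : ∀ a → ∃[ b ] Y a b
    right-total : ∀ b → ∃[ a ] Y a b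
open Bitotal

bitotal-map : {Y Y′ : A → B → Set} → (∀ {a b} → Y a b → Y′ a b) → Bitotal Y → Bitotal Y′
left-total  (bitotal-map f Y-bitotal) a = map₂ f (left-total Y-bitotal a)
right-total (bitotal-map f Y-bitotal) b = map₂ f (right-total Y-bitotal b)

module Graph {Y : Fin (suc n) → Fin (suc m) → Set} (Y-bitotal : Bitotal Y) where

  edge : Fin (suc n) ⊎ Fin (suc m) → Σ[ i ∈ Fin (suc n) ] Σ[ k ∈ Fin (suc m) ] Y i k
  edge (inj₁ i) = i , left-total Y-bitotal i
  edge (inj₂ k) = let i , y = right-total Y-bitotal k in i , k , y

  fst : Fin (suc n + suc m) → Fin (suc n)
  fst x = proj₁ (edge (splitAt (suc n) x))

  snd : Fin (suc n + suc m) → Fin (suc m)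
  snd x = proj₁ (proj₂ (edge (splitAt (suc n) x)))

  related : ∀ x → Y (fst x) (snd x)
  related x = proj₂ (proj₂ (edge (splitAt (suc n) x)))

  fst-onto : StrictlySurjective _≡_ fst
  fst-onto i = i ↑ˡ suc m , cong (proj₁ ∘ edge) (splitAt-↑ˡ (suc n) i (suc m))

  snd-onto : StrictlySurjective _≡_ snd
  snd-onto k = suc n ↑ʳ k , cong (proj₁ ∘ proj₂ ∘ edge) (splitAt-↑ʳ (suc n) (suc m) k)

_↾₀ : {n₀ m₀ : ℕ} → (World n m → World n₀ m₀ → Set) → Fin (suc n) → Fin (suc n₀) → Set
(Z ↾₀) i k = Z (c₀ i) (c₀ k)

_↾₁ : {n₀ m₀ : ℕ} → (World n m → World n₀ m₀ → Set) → Fin (suc m) → Fin (suc m₀) → Set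
(Z ↾₁) i k = Z (c₁ i) (c₁ k)

module Span {n₀ m₀ : ℕ} (Z : World n m → World n₀ m₀ → Set) (Z-root : Z root root)
            (Z₀ : Bitotal (Z ↾₀)) (Z₁ : Bitotal (Z ↾₁)) where

  fst : PMorphism (n + suc n₀) (m + suc m₀) n m
  fst = clusterwise (Graph.fst Z₀) (Graph.fst Z₁) (Graph.fst-onto Z₀) (Graph.fst-onto Z₁)

  snd : PMorphism (n + suc n₀) (m + suc m₀) n₀ m₀
  snd = clusterwise (Graph.snd Z₀) (Graph.snd Z₁) (Graph.snd-onto Z₀) (Graph.snd-onto Z₁)

  related : ∀ z → Z (to fst z) (to snd z)
  related root   = Z-root
  related (c₀ x) = Graph.related Z₀ x
  related (c₁ x) = Graph.related Z₁ x

-- Hall's theorem for two type sets and two clusters: Sᵢcⱼ means that cluster cⱼ realizes exactly Sᵢ.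
matching₂ : {S₀c₀ S₀c₁ S₁c₀ S₁c₁ : Set} →
            S₀c₀ ⊎ S₁c₀ → S₀c₁ ⊎ S₁c₁ → S₀c₀ ⊎ S₀c₁ → S₁c₀ ⊎ S₁c₁ → S₀c₀ × S₁c₁ ⊎ S₀c₁ × S₁c₀
matching₂ (inj₁ a) (inj₂ b) _        _        = inj₁ (a , b)
matching₂ (inj₂ a) (inj₁ b) _        _        = inj₂ (b , a)
matching₂ (inj₁ _) (inj₁ b) _        (inj₁ c) = inj₂ (b , c)
matching₂ (inj₁ a) (inj₁ _) _        (inj₂ c) = inj₁ (a , c)
matching₂ (inj₂ _) (inj₂ b) (inj₁ c) _        = inj₁ (c , b)
matching₂ (inj₂ a) (inj₂ _) (inj₂ c) _        = inj₂ (c , a)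

clamp : Dec A → Dec B → Bool → Bool → Bool
clamp (yes _) (yes _) α β = α
clamp (yes _) (no _)  α β = α ∨ β
clamp (no _)  (yes _) α β = α ∧ β
clamp (no _)  (no _)  α β = β

clamp-lower : ∀ (A? : Dec A) (B? : Dec B) {α β} → A → α ≡ true → clamp A? B? α β ≡ true
clamp-lower (yes _) (yes _) _ refl = refl
clamp-lower (yes _) (no _)  _ refl = refl
clamp-lower (no ¬a) _       a _    = ⊥-elim (¬a a)

clamp-upper : ∀ (A? : Dec A) (B? : Dec B) {α β} → B → clamp A? B? α β ≡ true → α ≡ true
clamp-upper (yes _) (yes _)         _ h  = h
clamp-upper (no _)  (yes _) {true}  _ _  = refl
clamp-upper _       (no ¬b)         b _  = ⊥-elim (¬b b)

clamp-sound : ∀ (A? : Dec A) (B? : Dec B) {α β} →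
              (A → α ≡ true → β ≡ true) → clamp A? B? α β ≡ true → β ≡ true
clamp-sound (yes a) (yes _)         forced h = forced a h
clamp-sound (yes a) (no _)  {true}  forced _ = forced a refl
clamp-sound (yes _) (no _)  {false} _      h = h
clamp-sound (no _)  (yes _) {true}  _      h = h
clamp-sound (no _)  (no _)          _      h = h

clamp-complete : ∀ (A? : Dec A) (B? : Dec B) {α β} →
                 (B → β ≡ true → α ≡ true) → β ≡ true → clamp A? B? α β ≡ true
clamp-complete (yes _) (yes b)         forced refl = forced b refl
clamp-complete (yes _) (no _)  {α}     _      refl = Bool.∨-zeroʳ α
clamp-complete (no _)  (yes _) {true}  _      refl = refl
clamp-complete (no _)  (yes b) {false} forced refl = forced b refl
clamp-complete (no _)  (no _)          _      refl = refl

sublists : List A → List (List A)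
sublists []       = [] ∷ []
sublists (x ∷ xs) = map (x ∷_) (sublists xs) ++ sublists xs

filter∈sublists : {P : Pred A 0ℓ} (P? : Decidable P) (xs : List A) → filter P? xs ∈ sublists xs
filter∈sublists P? []       = here refl
filter∈sublists P? (x ∷ xs) with does (P? x)
... | true  = ∈-++⁺ˡ (∈-map⁺ (x ∷_) (filter∈sublists P? xs))
... | false = ∈-++⁺ʳ (map (x ∷_) (sublists xs)) (filter∈sublists P? xs)

module Profiles (X : List Var) where

  -- An assignment to X is represented by the sublist of the variables it makes true.
  Assignment : Set
  Assignment = List Var

  assignments : List Assignment
  assignments = sublists X

  module _ (V : Valuation n m) where

    trueAt : World n m → Assignment
    trueAt u = filter (λ x → V x u Bool.≟ true) X

    trueAt∈assignments : ∀ u → trueAt u ∈ assignments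
    trueAt∈assignments u = filter∈sublists _ X

    ∈trueAt : ∀ {x u} → x ∈ X → V x u ≡ true → x ∈ trueAt u
    ∈trueAt = ∈-filter⁺ _

    ∈trueAt⁻ : ∀ {x u} → x ∈ trueAt u → V x u ≡ true
    ∈trueAt⁻ {u = u} = proj₂ ∘ ∈-filter⁻ (λ x → V x u Bool.≟ true) {xs = X}

    ∈?trueAt : ∀ {x u} → x ∈ X → does (x ∈? trueAt u) ≡ V x u
    ∈?trueAt {x} {u} x∈X with x ∈? trueAt u
    ... | yes x∈ = sym (∈trueAt⁻ x∈)
    ... | no x∉ with V x u in eq
    ...   | true  = ⊥-elim (x∉ (∈trueAt x∈X eq))
    ...   | false = refl

    module _ (e : Fin (suc d) → World n m) where

      realized? : Decidable (λ a → ∃[ k ] trueAt (e k) ≡ a)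
      realized? a = any? (λ k → ≡-dec _≟_ (trueAt (e k)) a)

      typesOf : List⁺ Assignment
      typesOf = trueAt (e zero) ∷ filter realized? assignments

      typesOf-bitotal : Bitotal (λ i k → lookup (toList typesOf) i ≡ trueAt (e k))
      left-total  typesOf-bitotal zero    = zero , refl
      left-total  typesOf-bitotal (suc j) =
        let k , eq = proj₂ (∈-filter⁻ realized? {xs = assignments} (∈-lookup j)) in k , sym eq
      right-total typesOf-bitotal k       = suc (index realized) , sym (lookup-index realized)
        where
        realized : trueAt (e k) ∈ filter realized? assignments
        realized = ∈-filter⁺ realized? (trueAt∈assignments (e k)) (k , refl)

  Profile : Set
  Profile = Assignment × List⁺ Assignment × List⁺ Assignment

  last₀ last₁ : Profile → ℕ
  last₀ (_ , S₀ , _) = length (tail S₀)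
  last₁ (_ , _ , S₁) = length (tail S₁)

  label : (π : Profile) → World (last₀ π) (last₁ π) → Assignment
  label (b , _  , _ ) root   = b
  label (_ , S₀ , _ ) (c₀ i) = lookup (toList S₀) i
  label (_ , _  , S₁) (c₁ i) = lookup (toList S₁) i

  canonical : (π : Profile) → Valuation (last₀ π) (last₁ π)
  canonical π p t = does (p ∈? label π t)

  clusterTypes : List (List⁺ Assignment)
  clusterTypes = cartesianProductWith _∷_ assignments (sublists assignments)

  profiles : List Profile
  profiles = cartesianProduct assignments (cartesianProduct clusterTypes clusterTypes)

  profileOf : Valuation n m → Profile
  profileOf V = trueAt V root , typesOf V c₀ , typesOf V c₁

  profileOf∈profiles : (V : Valuation n m) → profileOf V ∈ profiles
  profileOf∈profiles V =
    ∈-cartesianProduct⁺ (trueAt∈assignments V root) (∈-cartesianProduct⁺ (typesOf∈ c₀) (typesOf∈ c₁))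
    where
    typesOf∈ : (e : Fin (suc d) → World _ _) → typesOf V e ∈ clusterTypes
    typesOf∈ e =
      ∈-cartesianProductWith⁺ _∷_ (trueAt∈assignments V (e zero)) (filter∈sublists _ assignments)

  canonical-⊨ : (V : Valuation n m) (ψ : Fm) → (_∈ vars ψ) ⊆ (_∈ X) →
                V , root ⊨ ψ → canonical (profileOf V) , root ⊨ ψ
  canonical-⊨ {n} {m} V ψ vars⊆X h =
    ⊨-transfer fst (pullback V snd) (canonical π) ψ
      (λ pos z h′ → trans (agree (vars⊆X (v⁺⊆vars ψ pos)) z) h′)
      (λ neg z h′ → trans (sym (agree (vars⊆X (v⁻⊆vars ψ neg)) z)) h′)
      root (⊨-pullback snd V ψ root h)
    where
    π : Profile
    π = profileOf V

    Z : World (last₀ π) (last₁ π) → World n m → Set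
    Z t u = label π t ≡ trueAt V u

    open Span Z refl (typesOf-bitotal V c₀) (typesOf-bitotal V c₁)

    agree : ∀ {p} → p ∈ X → ∀ z → canonical π p (to fst z) ≡ V p (to snd z)
    agree {p} p∈X z = trans (cong (λ a → does (p ∈? a)) (related z)) (∈?trueAt V p∈X)

module Description (X : List Var) {P N : Pred Var 0ℓ} (P? : Decidable P) (N? : Decidable N) where
  open Profiles X

  literal : Assignment → Var → Fm
  literal a x = if does (x ∈? a) then when (P? x) (var x) else when (N? x) (¬' var x)

  describe : Assignment → Fm
  describe a = ⋀ X (literal a)

  clusterIs : List⁺ Assignment → Fm
  clusterIs S = □ ⋁ (toList S) describe ∧' ⋀ (toList S) (λ a → □ ◇ describe a)

  characteristic : Profile → Fm
  characteristic (b , S₀ , S₁) =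
    describe b ∧' ◇ clusterIs S₀ ∧' ◇ clusterIs S₁ ∧' □ ◇ (clusterIs S₀ ∨' clusterIs S₁)

  describe-within : ∀ a → Within P N (describe a)
  describe-within a = ⋀-within X literal-within
    where
    literal-within : ∀ x → Within P N (literal a x)
    literal-within x with does (x ∈? a)
    ... | true  = when-within (P? x) λ Px → (λ { refl → Px }) , (λ ())
    ... | false = when-within (N? x) λ Nx → (λ ()) , (λ { refl → Nx })

  clusterIs-within : ∀ S → Within P N (clusterIs S)
  clusterIs-within S = ∧-within (□-within (⋁-within (toList S) describe-within))
                                (⋀-within (toList S) (□-within ∘ ◇-within ∘ describe-within))

  characteristic-within : ∀ π → Within P N (characteristic π)
  characteristic-within (b , S₀ , S₁) =
    ∧-within (describe-within b)
      (∧-within (◇-within (clusterIs-within S₀))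
        (∧-within (◇-within (clusterIs-within S₁))
          (□-within (◇-within (∨-within (clusterIs-within S₀) (clusterIs-within S₁))))))

  Realizes : Valuation n m → List⁺ Assignment → (Fin (suc d) → World n m) → Set
  Realizes V S e = Bitotal (λ i k → V , e k ⊨ describe (lookup (toList S) i))

  module _ {V : Valuation n m} where

    describe-trueAt : ∀ u → V , u ⊨ describe (trueAt V u)
    describe-trueAt u = ⋀-intro X (literal (trueAt V u)) (literal-trueAt ∘ ∈-lookup)
      where
      literal-trueAt : ∀ {x} → x ∈ X → V , u ⊨ literal (trueAt V u) x
      literal-trueAt {x} x∈X with x ∈? trueAt V u
      ... | yes x∈ = when-intro (P? x) λ _ → ∈trueAt⁻ V x∈
      ... | no x∉  = when-intro (N? x) λ _ Vx → x∉ (∈trueAt V x∈X Vx)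

    describe-pos : ∀ {u a x} → x ∈ X → P x → V , u ⊨ describe a → does (x ∈? a) ≡ true → V x u ≡ true
    describe-pos {a = a} {x} x∈X Px h with x ∈? a | ⋀-elim (literal a) h x∈X
    ... | yes _ | lit = λ _ → when-elim (P? x) Px lit

    describe-neg : ∀ {u a x} → x ∈ X → N x → V , u ⊨ describe a → V x u ≡ true → does (x ∈? a) ≡ true
    describe-neg {a = a} {x} x∈X Nx h with x ∈? a | ⋀-elim (literal a) h x∈X
    ... | yes _ | _   = λ _ → refl
    ... | no _  | lit = ⊥-elim ∘ when-elim (N? x) Nx lit

    realizes-typesOf : (e : Fin (suc d) → World n m) → Realizes V (typesOf V e) e
    realizes-typesOf e =
      bitotal-map (λ {_} {k} eq → subst (λ a → V , e k ⊨ describe a) (sym eq) (describe-trueAt (e k)))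
                  (typesOf-bitotal V e)

    realizes-pullback : ∀ {S} {e : Fin (suc d) → World n′ m′} (f : PMorphism n′ m′ n m) →
                      Realizes V S (to f ∘ e) → Realizes (pullback V f) S e
    realizes-pullback {e = e} f = bitotal-map λ {_} {k} → ⊨-pullback f V _ (e k)

    module _ {S : List⁺ Assignment} {e : Fin (suc d) → World n m} (e-cluster : IsCluster e) where

      clusterIs-intro : Realizes V S e → ∀ k → V , e k ⊨ clusterIs S
      clusterIs-intro cover k = typed , ⋀-intro (toList S) _ reachable
        where
        typed : ∀ v → R (e k) v → V , v ⊨ ⋁ (toList S) describe
        typed v r with closed e-cluster k r
        ... | k′ , refl = let i , h = right-total cover k′ in ⋁-intro (∈-lookup i) h

        reachable : ∀ i v → R (e k) v → V , v ⊨ (◇ describe (lookup (toList S) i))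
        reachable i v r with closed e-cluster k r
        ... | k′ , refl = let k″ , h = left-total cover i in ◇-intro _ (connected e-cluster k′ k″) h

      clusterIs-elim : ∀ {u} → (∀ k → R u (e k)) → V , u ⊨ clusterIs S → Realizes V S e
      left-total  (clusterIs-elim sees (_ , reachable)) i =
        ◇-in-cluster e-cluster _ (⋀-elim _ reachable (∈-lookup i) (e zero) (sees zero))
      right-total (clusterIs-elim sees (typed , _)) k = ⋁-elim (toList S) describe (typed (e k) (sees k))

    module _ {b : Assignment} {S₀ S₁ : List⁺ Assignment} where

      characteristic-intro : V , root ⊨ describe b → Realizes V S₀ c₀ → Realizes V S₁ c₁ →
                             V , root ⊨ characteristic (b , S₀ , S₁)
      characteristic-intro hb realizes₀ realizes₁ =
        hb , ◇-intro {u = root} (clusterIs S₀) tt (in₀ zero) , ◇-intro {u = root} (clusterIs S₁) tt (in₁ zero)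
           , everywhere
        where
        in₀ : ∀ k → V , c₀ k ⊨ clusterIs S₀
        in₀ = clusterIs-intro c₀-cluster realizes₀

        in₁ : ∀ k → V , c₁ k ⊨ clusterIs S₁
        in₁ = clusterIs-intro c₁-cluster realizes₁

        either : Fm
        either = clusterIs S₀ ∨' clusterIs S₁

        everywhere : ∀ v → R root v → V , v ⊨ (◇ either)
        everywhere root   _ = ◇-intro {u = root} {c₀ zero} either tt (inj₁ (in₀ zero))
        everywhere (c₀ k) _ = ◇-intro {v = c₀ k} either tt (inj₁ (in₀ k))
        everywhere (c₁ k) _ = ◇-intro {v = c₁ k} either tt (inj₂ (in₁ k))

      characteristic-elim : V , root ⊨ characteristic (b , S₀ , S₁) →
                            V , root ⊨ describe b ×
                            (Realizes V S₀ c₀ × Realizes V S₁ c₁ ⊎ Realizes V S₀ c₁ × Realizes V S₁ c₀)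
      characteristic-elim (hb , ◇S₀ , ◇S₁ , everywhere) =
        hb , matching₂ (seen-from c₀-cluster (everywhere (c₀ zero) tt))
                       (seen-from c₁-cluster (everywhere (c₁ zero) tt)) (at-root ◇S₀) (at-root ◇S₁)
        where
        at-root : ∀ {S} → V , root ⊨ (◇ clusterIs S) → Realizes V S c₀ ⊎ Realizes V S c₁
        at-root {S} h with ◇-elim {V = V} {root} (clusterIs S) h
        ... | root , _ , h′ = inj₁ (clusterIs-elim c₀-cluster (λ _ → tt) h′)
        ... | c₀ _ , _ , h′ = inj₁ (clusterIs-elim c₀-cluster (λ _ → tt) h′)
        ... | c₁ _ , _ , h′ = inj₂ (clusterIs-elim c₁-cluster (λ _ → tt) h′)

        seen-from : {e : Fin (suc d) → World n m} → IsCluster e →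
                    V , e zero ⊨ (◇ (clusterIs S₀ ∨' clusterIs S₁)) → Realizes V S₀ e ⊎ Realizes V S₁ e
        seen-from e-cluster h =
          let k , h′ = ◇-in-cluster {V = V} e-cluster (clusterIs S₀ ∨' clusterIs S₁) h
          in Sum.map (clusterIs-elim e-cluster (connected e-cluster k))
                     (clusterIs-elim e-cluster (connected e-cluster k)) h′

module Interpolant (φ : Fm) (P⁺ P⁻ : List Var) where

  X : List Var
  X = vars φ

  Allowed⁺ Allowed⁻ : Pred Var 0ℓ
  Allowed⁺ p = Pos p φ × p ∉ P⁺
  Allowed⁻ p = Neg p φ × p ∉ P⁻

  allowed⁺? : Decidable Allowed⁺
  allowed⁺? p = Pos? p φ ×-dec ¬? (p ∈? P⁺)

  allowed⁻? : Decidable Allowed⁻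
  allowed⁻? p = Neg? p φ ×-dec ¬? (p ∈? P⁻)

  open Profiles X
  open Description X allowed⁺? allowed⁻?

  canonical-⊨-φ? : Decidable (λ π → canonical π , root ⊨ φ)
  canonical-⊨-φ? π = canonical π , root ⊨? φ

  φ-profiles : List Profile
  φ-profiles = filter canonical-⊨-φ? profiles

  interpolant : Fm
  interpolant = ⋁ φ-profiles characteristic

  interpolant-within : Within Allowed⁺ Allowed⁻ interpolant
  interpolant-within = ⋁-within φ-profiles characteristic-within

  φ⇒interpolant : (V : Valuation n m) → V , root ⊨ φ → V , root ⊨ interpolant
  φ⇒interpolant V h =
    ⋁-intro (∈-filter⁺ canonical-⊨-φ? (profileOf∈profiles V) (canonical-⊨ V φ id h))
            (characteristic-intro {b = trueAt V root}
              (describe-trueAt root) (realizes-typesOf c₀) (realizes-typesOf c₁))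

  module _ {ψ : Fm} (⊢φ⇒ψ : ΓLV (φ ⇒ ψ)) (ψ⁺ : v⁺ ψ ⊆ (_∉ P⁺)) (ψ⁻ : v⁻ ψ ⊆ (_∉ P⁻)) where

    realizes⇒ψ : ∀ {b S₀ S₁} (V : Valuation n m) → canonical (b , S₀ , S₁) , root ⊨ φ →
                V , root ⊨ describe b → Realizes V S₀ c₀ → Realizes V S₁ c₁ → V , root ⊨ ψ
    realizes⇒ψ {n} {m} {b} {S₀} {S₁} V φ-canonical hb realizes₀ realizes₁ =
      ⊨-transfer snd W V ψ ψ-up ψ-down root (⊢φ⇒ψ _ _ W root W-⊨-φ)
      where
      π : Profile
      π = b , S₀ , S₁

      Z : World (last₀ π) (last₁ π) → World n m → Set
      Z t u = V , u ⊨ describe (label π t)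

      open Span Z hb realizes₀ realizes₁

      -- W is V pushed towards the canonical valuation: up on variables positive in φ, down on variables
      -- negative in φ. So φ is reflected from the canonical model to W, and since Z pins V to the canonical
      -- valuation on the literals ψ may use, ψ transfers from W to V.
      W : Valuation (last₀ π + suc n) (last₁ π + suc m)
      W p z = clamp (Pos? p φ) (Neg? p φ) (canonical π p (to fst z)) (V p (to snd z))

      W-⊨-φ : W , root ⊨ φ
      W-⊨-φ = ⊨-reflect fst W (canonical π) φ
                (λ {p} neg _ → clamp-upper (Pos? p φ) (Neg? p φ) neg)
                (λ {p} pos _ → clamp-lower (Pos? p φ) (Neg? p φ) pos)
                root φ-canonical

      ψ-up : v⁺ ψ ⊆ Up snd W V
      ψ-up {p} pos z = clamp-sound (Pos? p φ) (Neg? p φ) λ φ-pos →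
        describe-pos {a = label π (to fst z)} (v⁺⊆vars φ φ-pos) (φ-pos , ψ⁺ pos) (related z)

      ψ-down : v⁻ ψ ⊆ Down snd W V
      ψ-down {p} neg z = clamp-complete (Pos? p φ) (Neg? p φ) λ φ-neg →
        describe-neg {a = label π (to fst z)} (v⁻⊆vars φ φ-neg) (φ-neg , ψ⁻ neg) (related z)

    characteristic⇒ψ : ∀ {b S₀ S₁} (V : Valuation n m) → canonical (b , S₀ , S₁) , root ⊨ φ →
                      V , root ⊨ characteristic (b , S₀ , S₁) → V , root ⊨ ψ
    characteristic⇒ψ {b = b} {S₀} {S₁} V φ-canonical hχ = [ uncurry aligned , uncurry crossed ] matched
      where
      hb : V , root ⊨ describe b
      hb = proj₁ (characteristic-elim {V = V} {b = b} {S₀} {S₁} hχ)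

      matched : Realizes V S₀ c₀ × Realizes V S₁ c₁ ⊎ Realizes V S₀ c₁ × Realizes V S₁ c₀
      matched = proj₂ (characteristic-elim {V = V} {b = b} {S₀} {S₁} hχ)

      aligned : Realizes V S₀ c₀ → Realizes V S₁ c₁ → V , root ⊨ ψ
      aligned = realizes⇒ψ V φ-canonical hb

      crossed : Realizes V S₀ c₁ → Realizes V S₁ c₀ → V , root ⊨ ψ
      crossed realizes₀ realizes₁ =
        pullback-⊨ swap V ψ root
          (realizes⇒ψ (pullback V swap) φ-canonical (⊨-pullback swap V (describe b) root hb)
                     (realizes-pullback swap realizes₀) (realizes-pullback swap realizes₁))

    interpolant⇒ψ : (V : Valuation n m) → V , root ⊨ interpolant → V , root ⊨ ψ
    interpolant⇒ψ V h =
      let i , hχ = ⋁-elim φ-profiles characteristic h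
      in characteristic⇒ψ V (proj₂ (∈-filter⁻ canonical-⊨-φ? {xs = profiles} (∈-lookup i))) hχ

theorem7p3 : UniformLyndonInterpolation ΓLV
theorem7p3 φ P⁺ P⁻ =
    interpolant
  , ΓLV-from-roots (φ ⇒ interpolant) (λ _ _ → φ⇒interpolant)
  , (λ _ → pos interpolant-within)
  , (λ _ → neg interpolant-within)
  , λ ψ ⊢φ⇒ψ ψ⁺ ψ⁻ → ΓLV-from-roots (interpolant ⇒ ψ) (λ _ _ → interpolant⇒ψ ⊢φ⇒ψ (ψ⁺ _) (ψ⁻ _))
  where open Interpolant φ P⁺ P⁻
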